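{- Suppose the addition of an arc $(v,w)$ to an acyclic graph with topological order $<$ triggers a compatible search (i.e. $v>w$) but does not create a cycle. Let $(u,x)$ be an arc traversed forward and $(y,z)$ an arc traversed backward during this search (not necessarily in the same search step) such that $u<z$. Then $(u,x)$ and $(y,z)$ are unrelated before the addition of $(v,w)$ but are related after the addition.
   Context: Two distinct arcs are related if some directed path contains both of them (in either order), and unrelated otherwise. Compatible search triggered by adding $(v,w)$ with $v>w$ (comparisons in the order before the addition, arcs of the graph before the addition): set $F=\{w\}$, $B=\{v\}$, $A_F=\{\text{arcs out of } w\}$, $A_B=\{\text{arcs into } v\}$. While there exist $(u,x)\in A_F$ and $(y,z)\in A_B$ with $u<z$: choose any such pair and remove them from $A_F$, $A_B$ respectively (a forward traversal of $(u,x)$ and a backward traversal of $(y,z)$); if $x\in B$ or $y\in F$ stop reporting a cycle; if $x\notin F$, add $x$ to $F$ and all arcs out of $x$ to $A_F$; if $y\notin B$, add $y$ to $B$ and all arcs into $y$ to $A_B$. -}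

module Defs where

open import Data.Nat using (ℕ; _<_)
open import Data.Fin using (Fin)
open import Data.Product using (Σ; ∃; ∃-syntax; _×_; _,_; proj₁; proj₂)
open import Data.Sum using (_⊎_)
open import Data.List using (List; []; _∷_)
open import Data.List.Relation.Unary.Linked using (Linked)
open import Data.List.Relation.Unary.Any using (Any)
open import Data.List.Relation.Unary.Unique.Propositional using (Unique)
open import Relation.Binary.PropositionalEquality using (_≡_; _≢_)
open import Relation.Binary.Construct.Closure.Transitive using (TransClosure)
open import Relation.Nullary using (¬_)
open import Function.Definitions using (Injective)

Vertex : ℕ → Set
Vertex n = Fin n

Arc : ℕ → Set
Arc n = Vertex n × Vertex n

Graph : ℕ → Set₁
Graph n = Vertex n → Vertex n → Set

addArc : ∀ {n} → Graph n → Vertex n → Vertex n → Graph n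
addArc E v w a b = E a b ⊎ (a ≡ v × b ≡ w)

Acyclic : ∀ {n} → Graph n → Set
Acyclic E = ∀ a → ¬ TransClosure E a a

-- A total order on the vertices, given by an injective position map:
-- a precedes b iff pos a < pos b.
-- It is a topological order of E if every arc goes forward.
IsTopOrder : ∀ {n} → Graph n → (Vertex n → ℕ) → Set
IsTopOrder E pos = Injective _≡_ _≡_ pos × (∀ a b → E a b → pos a < pos b)

data ArcOn {n} (a b : Vertex n) : List (Vertex n) → Set where
  here  : ∀ {vs} → ArcOn a b (a ∷ b ∷ vs)
  there : ∀ {c vs} → ArcOn a b vs → ArcOn a b (c ∷ vs)

IsPath : ∀ {n} → Graph n → List (Vertex n) → Set
IsPath E vs = Linked E vs × Unique vs

Related : ∀ {n} → Graph n → Arc n → Arc n → Set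
Related {n} E (a , b) (c , d) =
  (a , b) ≢ (c , d) ×
  Σ (List (Vertex n)) (λ vs → IsPath E vs × ArcOn a b vs × ArcOn c d vs)

record SearchState (n : ℕ) : Set₁ where
  field
    F  : Vertex n → Set
    B  : Vertex n → Set
    AF : Vertex n → Vertex n → Set
    AB : Vertex n → Vertex n → Set
open SearchState public

initState : ∀ {n} → Graph n → Vertex n → Vertex n → SearchState n
initState E v w = record
  { F  = λ a → a ≡ w
  ; B  = λ a → a ≡ v
  ; AF = λ a b → a ≡ w × E a b
  ; AB = λ a b → b ≡ v × E a b
  }

CanChoose : ∀ {n} → (Vertex n → ℕ) → SearchState n → Arc n → Arc n → Set
CanChoose pos s (u , x) (y , z) = AF s u x × AB s y z × pos u < pos z

-- After the removal, the search stops reporting a cycle.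
Stops : ∀ {n} → SearchState n → Arc n → Arc n → Set
Stops s (u , x) (y , z) = B s x ⊎ F s y

nextState : ∀ {n} → Graph n → SearchState n → Arc n → Arc n → SearchState n
nextState E s (u , x) (y , z) = record
  { F  = λ a → F s a ⊎ (¬ F s x × a ≡ x)
  ; B  = λ a → B s a ⊎ (¬ B s y × a ≡ y)
  ; AF = λ a b → (AF s a b × (a , b) ≢ (u , x)) ⊎ (¬ F s x × a ≡ x × E a b)
  ; AB = λ a b → (AB s a b × (a , b) ≢ (y , z)) ⊎ (¬ B s y × b ≡ y × E a b)
  }

-- A (partial) execution of the search from state s, recording for each step
-- the pair (arc traversed forward , arc traversed backward).  The choice in
-- each step is arbitrary; a step that reports a cycle ends the execution.
data Run {n} (E : Graph n) (pos : Vertex n → ℕ) :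
         SearchState n → List (Arc n × Arc n) → Set₁ where
  done : ∀ {s} → Run E pos s []
  stop : ∀ {s e f} → CanChoose pos s e f → Stops s e f →
         Run E pos s ((e , f) ∷ [])
  step : ∀ {s e f tr} → CanChoose pos s e f → ¬ Stops s e f →
         Run E pos (nextState E s e f) tr → Run E pos s ((e , f) ∷ tr)

TraversedForward : ∀ {n} → Arc n → List (Arc n × Arc n) → Set
TraversedForward e tr = Any (λ p → proj₁ p ≡ e) tr

TraversedBackward : ∀ {n} → Arc n → List (Arc n × Arc n) → Set
TraversedBackward f tr = Any (λ p → proj₂ p ≡ f) tr

module Submission where

-- Adding (v , w) with pos w < pos v starts a search that grows F forward
-- from w and B backward from v.  Its invariant: vertices of F are reachable
-- from w, vertices of B reach v, arcs of A_F leave vertices reachable from w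
-- and arcs of A_B enter vertices reaching v.  So a forward-traversed arc
-- (u , x) and a backward-traversed arc (y , z) give old walks w ⇝ u → x and
-- y → z ⇝ v.  As the new graph is acyclic, the old one has no walk w ⇝ v;
-- this rules out stopping steps and yields both halves of the lemma:
--   * after the addition, y → z ⇝ v → w ⇝ u → x is a walk of an acyclic
--     graph, hence a path containing both arcs;
--   * before it, a path through both arcs would lead from x to y (closing a
--     walk w ⇝ v), from z to u (against pos u < pos z), or the arcs coincide.

open import Defs
open import Data.Nat using (ℕ; _<_; _≤_)
open import Data.Nat.Properties using (≤-refl; ≤-trans; <⇒≤; <⇒≱)
open import Data.Product using (_×_; _,_; proj₁; proj₂)
open import Data.Sum using (_⊎_; inj₁; inj₂)
open import Data.List using (List; []; _∷_)
open import Data.List.Relation.Unary.Linked using (Linked; [-]; _∷_)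
import Data.List.Relation.Unary.Linked as Linked
open import Data.List.Relation.Unary.Linked.Properties using (Linked⇒AllPairs)
import Data.List.Relation.Unary.AllPairs as AllPairs
open import Data.List.Relation.Unary.Any using (here; there)
open import Relation.Binary.PropositionalEquality using (_≡_; _≢_; refl)
open import Relation.Binary.Construct.Closure.Transitive as Plus
  using (TransClosure; [_]; _∷_)
open import Relation.Binary.Construct.Closure.ReflexiveTransitive as Star
  using (Star; ε; _◅_; _◅◅_)
open import Relation.Nullary using (¬_)
open import Data.Empty using (⊥-elim)

module _ {n : ℕ} where

  vertices : ∀ {R : Graph n} {a b} → Star R a b → List (Vertex n)
  vertices {a = a} ε       = a ∷ []
  vertices {a = a} (_ ◅ p) = a ∷ vertices p

  vertices-linked : ∀ {R : Graph n} {a b} (p : Star R a b) → Linked R (vertices p)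
  vertices-linked ε           = [-]
  vertices-linked (e ◅ ε)     = e ∷ [-]
  vertices-linked (e ◅ f ◅ p) = e ∷ vertices-linked (f ◅ p)

  arcOn-first : ∀ {R : Graph n} {a b c} (e : R a b) (p : Star R b c) →
                ArcOn a b (vertices (e ◅ p))
  arcOn-first e ε       = here
  arcOn-first e (_ ◅ _) = here

  arcOn-◅◅ : ∀ {R : Graph n} {a b c s t} (p : Star R a b) (q : Star R b c) →
             ArcOn s t (vertices q) → ArcOn s t (vertices (p ◅◅ q))
  arcOn-◅◅ ε       q h = h
  arcOn-◅◅ (_ ◅ p) q h = there (arcOn-◅◅ p q h)

  arc◅walk : ∀ {R : Graph n} {a b c} → R a b → Star R b c → TransClosure R a c
  arc◅walk e ε       = [ e ]
  arc◅walk e (f ◅ p) = e ∷ arc◅walk f p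

  acyclic-linked-unique : ∀ {R : Graph n} {vs} → Acyclic R → Linked R vs →
                          AllPairs.AllPairs _≢_ vs
  acyclic-linked-unique {R} acyclic linked =
    AllPairs.map (λ { t refl → acyclic _ t })
      (Linked⇒AllPairs (Plus.transitive R) (Linked.map [_] linked))

  walk-isPath : ∀ {R : Graph n} {a b} → Acyclic R → (p : Star R a b) →
                IsPath R (vertices p)
  walk-isPath acyclic p =
    vertices-linked p , acyclic-linked-unique acyclic (vertices-linked p)

  walk-to-arc : ∀ {R : Graph n} {a c d vs} → Linked R (a ∷ vs) →
                ArcOn c d (a ∷ vs) → Star R a c
  walk-to-arc _       here      = ε
  walk-to-arc (e ∷ l) (there h) = e ◅ walk-to-arc l h

  arcOn-order : ∀ {R : Graph n} {a b c d vs} → Linked R vs →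
                ArcOn a b vs → ArcOn c d vs →
                Star R b c ⊎ Star R d a ⊎ (a ≡ c × b ≡ d)
  arcOn-order _       here      here       = inj₂ (inj₂ (refl , refl))
  arcOn-order (_ ∷ l) here      (there h)  = inj₁ (walk-to-arc l h)
  arcOn-order (_ ∷ l) (there h) here       = inj₂ (inj₁ (walk-to-arc l h))
  arcOn-order (_ ∷ l) (there h) (there h') = arcOn-order l h h'
  arcOn-order [-]     (there ()) _

  topOrder-walk : ∀ {E : Graph n} {pos} → IsTopOrder E pos →
                  ∀ {a b} → Star E a b → pos a ≤ pos b
  topOrder-walk top             ε       = ≤-refl
  topOrder-walk top@(_ , forward) (e ◅ p) =
    ≤-trans (<⇒≤ (forward _ _ e)) (topOrder-walk top p)

  lift : ∀ {E : Graph n} {v w a b} → Star E a b → Star (addArc E v w) a b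
  lift = Star.map inj₁

  no-walk-back : ∀ {E : Graph n} {v w} → Acyclic (addArc E v w) → ¬ Star E w v
  no-walk-back acyclic p = acyclic _ (arc◅walk (inj₂ (refl , refl)) (lift p))

  module _ {E : Graph n} {v w u x y z : Vertex n}
           (w⇝u : Star E w u) (u→x : E u x) (y→z : E y z) (z⇝v : Star E z v) where

    related-after : Acyclic (addArc E v w) → Related (addArc E v w) (u , x) (y , z)
    related-after acyclic = distinct , vertices walk , walk-isPath acyclic walk ,
                            arcOn-◅◅ z-part _ (arcOn-◅◅ w-part _ here) ,
                            arcOn-first (inj₁ y→z) (lift z⇝v ◅◅ _)
      where
        z-part : Star (addArc E v w) y v
        z-part = inj₁ y→z ◅ lift z⇝v
        w-part : Star (addArc E v w) v u
        w-part = inj₂ (refl , refl) ◅ lift w⇝u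
        walk : Star (addArc E v w) y x
        walk = z-part ◅◅ w-part ◅◅ (inj₁ u→x ◅ ε)
        distinct : (u , x) ≢ (y , z)
        distinct refl = no-walk-back acyclic (w⇝u ◅◅ u→x ◅ z⇝v)

    unrelated-before : ∀ {pos} → IsTopOrder E pos → ¬ Star E w v → pos u < pos z →
                       ¬ Related E (u , x) (y , z)
    unrelated-before top no-w⇝v u<z (distinct , _ , (linked , _) , on-ux , on-yz)
      with arcOn-order linked on-ux on-yz
    ... | inj₁ x⇝y                 = no-w⇝v (w⇝u ◅◅ u→x ◅ x⇝y ◅◅ y→z ◅ z⇝v)
    ... | inj₂ (inj₁ z⇝u)          = <⇒≱ u<z (topOrder-walk top z⇝u)
    ... | inj₂ (inj₂ (refl , refl)) = distinct refl

  record SearchInvariant (E : Graph n) (v w : Vertex n) (s : SearchState n) : Set where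
    field
      F-reached  : ∀ {a} → F s a → Star E w a
      B-reaches  : ∀ {a} → B s a → Star E a v
      AF-reached : ∀ {a b} → AF s a b → Star E w a × E a b
      AB-reaches : ∀ {a b} → AB s a b → E a b × Star E b v

  module Search {E : Graph n} {v w : Vertex n} where
    open SearchInvariant

    initial : SearchInvariant E v w (initState E v w)
    initial = record
      { F-reached  = λ { refl → ε }
      ; B-reaches  = λ { refl → ε }
      ; AF-reached = λ { (refl , e) → ε , e }
      ; AB-reaches = λ { (refl , e) → e , ε }
      }

    preserved : ∀ {s u x y z} → SearchInvariant E v w s → AF s u x → AB s y z →
                SearchInvariant E v w (nextState E s (u , x) (y , z))
    preserved {u = u} {x} {y} {z} inv u→x∈AF y→z∈AB = record
      { F-reached  = λ { (inj₁ a∈F) → F-reached inv a∈F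
                       ; (inj₂ (_ , refl)) → w⇝x }
      ; B-reaches  = λ { (inj₁ a∈B) → B-reaches inv a∈B
                       ; (inj₂ (_ , refl)) → y⇝v }
      ; AF-reached = λ { (inj₁ (a→b∈AF , _)) → AF-reached inv a→b∈AF
                       ; (inj₂ (_ , refl , e)) → w⇝x , e }
      ; AB-reaches = λ { (inj₁ (a→b∈AB , _)) → AB-reaches inv a→b∈AB
                       ; (inj₂ (_ , refl , e)) → e , y⇝v }
      }
      where
        w⇝x : Star E w x
        w⇝x with AF-reached inv u→x∈AF
        ... | w⇝u , u→x = w⇝u ◅◅ u→x ◅ ε
        y⇝v : Star E y v
        y⇝v with AB-reaches inv y→z∈AB
        ... | y→z , z⇝v = y→z ◅ z⇝v

    -- Without a walk w ⇝ v the search never stops: a stop would close one.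
    never-stops : ¬ Star E w v → ∀ {s u x y z} → SearchInvariant E v w s →
                  AF s u x → AB s y z → ¬ Stops s (u , x) (y , z)
    never-stops no-w⇝v inv u→x∈AF _ (inj₁ x∈B) with AF-reached inv u→x∈AF
    ... | w⇝u , u→x = no-w⇝v (w⇝u ◅◅ u→x ◅ B-reaches inv x∈B)
    never-stops no-w⇝v inv _ y→z∈AB (inj₂ y∈F) with AB-reaches inv y→z∈AB
    ... | y→z , z⇝v = no-w⇝v (F-reached inv y∈F ◅◅ y→z ◅ z⇝v)

    module _ (no-w⇝v : ¬ Star E w v) {pos : Vertex n → ℕ} where

      traversed-forward : ∀ {s tr u x} → SearchInvariant E v w s → Run E pos s tr →
                          TraversedForward (u , x) tr → Star E w u × E u x
      traversed-forward inv (stop (af , ab , _) stops) _ =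
        ⊥-elim (never-stops no-w⇝v inv af ab stops)
      traversed-forward inv (step (af , _) _ _) (here refl) = AF-reached inv af
      traversed-forward inv (step (af , ab , _) _ run) (there t) =
        traversed-forward (preserved inv af ab) run t

      traversed-backward : ∀ {s tr y z} → SearchInvariant E v w s → Run E pos s tr →
                           TraversedBackward (y , z) tr → E y z × Star E z v
      traversed-backward inv (stop (af , ab , _) stops) _ =
        ⊥-elim (never-stops no-w⇝v inv af ab stops)
      traversed-backward inv (step (_ , ab , _) _ _) (here refl) = AB-reaches inv ab
      traversed-backward inv (step (af , ab , _) _ run) (there t) =
        traversed-backward (preserved inv af ab) run t

lemma3p2 : ∀ {n} (E : Graph n) (pos : Vertex n → ℕ) (v w : Vertex n) →
    Acyclic E → IsTopOrder E pos → pos w < pos v →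
    Acyclic (addArc E v w) →
    (tr : List (Arc n × Arc n)) → Run E pos (initState E v w) tr →
    (u x y z : Vertex n) →
    TraversedForward (u , x) tr → TraversedBackward (y , z) tr → pos u < pos z →
    ¬ Related E (u , x) (y , z) × Related (addArc E v w) (u , x) (y , z)
lemma3p2 E pos v w _ top _ acyclic-after tr run u x y z forward backward u<z =
  unrelated-before w⇝u u→x y→z z⇝v top no-w⇝v u<z ,
  related-after w⇝u u→x y→z z⇝v acyclic-after
  where
    no-w⇝v : ¬ Star E w v
    no-w⇝v = no-walk-back acyclic-after

    forward-walk : Star E w u × E u x
    forward-walk = Search.traversed-forward no-w⇝v Search.initial run forward

    backward-walk : E y z × Star E z v
    backward-walk = Search.traversed-backward no-w⇝v Search.initial run backward

    w⇝u : Star E w u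
    w⇝u = proj₁ forward-walk
    u→x : E u x
    u→x = proj₂ forward-walk
    y→z : E y z
    y→z = proj₁ backward-walk
    z⇝v : Star E z v
    z⇝v = proj₂ backward-walk
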